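{- Let $\phi$ be a $\mathbf{Gr}(\mathbf{K}_\mathcal{R})$-formula in negation normal form and let $S$ be a constraint system generated by the optimised algorithm starting from $\{x_0\models\phi\}$. Then (i) the length of every path in the graph $G(S)$ is at most $|\phi|$, and (ii) the out-degree of every node of $G(S)$ is at most $|\mathit{clos}(\phi)|\times 2^{|\phi|}$.
   Context: Formulae (in negation normal form, NNF) are: atoms $p$, negated atoms $\neg p$, $\psi_1\wedge\psi_2$, $\psi_1\vee\psi_2$, $\langle R\rangle_{\ge n}\psi$, $\langle R\rangle_{\le n}\psi$ ($R$ a relation name, $n\in\mathbb{N}$), with $\mathfrak{M},x\models\langle R\rangle_{\ge n}\psi$ iff $x$ has at least $n$ $R$-successors satisfying $\psi$, and $\langle R\rangle_{\le n}\psi$ iff at most $n$. $\sim\psi$ denotes the NNF of $\neg\psi$ (obtained by De Morgan laws and $\neg\langle R\rangle_{\ge 0}\psi\equiv p\wedge\neg p$, $\neg\langle R\rangle_{\ge n}\psi\equiv\langle R\rangle_{\le n-1}\psi$ for $n\ge1$, $\neg\langle R\rangle_{\le n}\psi\equiv\langle R\rangle_{\ge n+1}\psi$). $|\phi|$ is the length of $\phi$ with numbers written in binary. A constraint system (c.s.) is a finite set of expressions $x\models\psi$ and $Rxy$ with $x,y$ variables; $\sharp R^S(x,\psi)$ is the number of $y$ with $\{Rxy,y\models\psi\}\subseteq S$. The optimised algorithm starts from $\{x_0\models\phi\}$ and nondeterministically applies the rules: ($\wedge$) if $x\models\psi_1\wedge\psi_2\in S$ and $\{x\models\psi_1,x\models\psi_2\}\not\subseteq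 S$, add both; ($\vee$) if $x\models\psi_1\vee\psi_2\in S$ and neither $x\models\psi_1$ nor $x\models\psi_2$ is in $S$, add $x\models\chi$ for some $\chi\in\{\psi_1,\psi_2\}$; ($\ge$) if $x\models\langle R\rangle_{\ge n}\psi\in S$, $\sharp R^S(x,\psi)<n$, and neither the $\wedge$- nor the $\vee$-rule applies to a constraint for $x$, then add $Rxy$, $y\models\psi$, $y\models\chi_1,\dots,y\models\chi_k$ for a fresh variable $y$, where $\{\psi_1,\dots,\psi_k\}=\{\psi':x\models\langle R\rangle_{\bowtie m}\psi'\in S$ for some $m$ and $\bowtie\in\{\le,\ge\}\}$ and each $\chi_i\in\{\psi_i,\sim\psi_i\}$ is chosen nondeterministically. $G(S)$ is the graph whose nodes are the variables of $S$, with an edge $xy$ iff $Rxy\in S$ for some $R$. $\mathit{clos}(\phi)$ is the smallest set containing $\phi$, closed under taking immediate subformulae of $\wedge,\vee$ and the argument $\psi$ of $\langle R\rangle_{\bowtie n}\psi$, and closed under $\psi\mapsto\sim\psi$. -}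

module Defs where

open import Data.Nat using (ℕ; zero; suc; _+_; _*_; _^_; _≤_; _<_)
open import Data.Nat.Logarithm using (⌊log₂_⌋)
import Data.Nat.Properties as ℕP
open import Data.Bool using (Bool; true; false; if_then_else_)
open import Data.Maybe using (Maybe; just; nothing)
open import Data.List using (List; []; _∷_; _++_; length; map; mapMaybe; deduplicate)
open import Data.List.Membership.Propositional using (_∈_; _∉_)
import Data.List.Membership.DecPropositional as DecMem
open import Data.Product using (Σ; ∃; ∃-syntax; _×_; _,_)
open import Data.Sum using (_⊎_)
open import Relation.Nullary using (¬_; Dec; yes; no; does)
open import Relation.Binary.PropositionalEquality using (_≡_; refl; cong; cong₂)
open import Relation.Binary.Definitions using (DecidableEquality)
open import Relation.Binary.Construct.Closure.ReflexiveTransitive using (Star)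

-- Formulae of Gr(K_R) in negation normal form.
-- Propositional atoms and relation names are natural numbers.

data Fm : Set where
  atom  : ℕ → Fm
  natom : ℕ → Fm
  _∧'_  : Fm → Fm → Fm
  _∨'_  : Fm → Fm → Fm
  geq   : ℕ → ℕ → Fm → Fm        -- geq R n ψ  =  ⟨R⟩_{≥ n} ψ
  leq   : ℕ → ℕ → Fm → Fm        -- leq R n ψ  =  ⟨R⟩_{≤ n} ψ

-- ∼ψ : the NNF of ¬ψ.  The atom p used for ¬⟨R⟩_{≥0}ψ ≡ p ∧ ¬p is atom 0.
∼_ : Fm → Fm
∼ atom p      = natom p
∼ natom p     = atom p
∼ (a ∧' b)    = (∼ a) ∨' (∼ b)
∼ (a ∨' b)    = (∼ a) ∧' (∼ b)
∼ geq R zero ψ    = atom 0 ∧' natom 0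
∼ geq R (suc n) ψ = leq R n ψ
∼ leq R n ψ   = geq R (suc n) ψ

-- number of binary digits of n (0 has one digit)
bitlen : ℕ → ℕ
bitlen n = suc ⌊log₂ n ⌋

-- |φ| : length of φ, numbers written in binary
∣_∣ : Fm → ℕ
∣ atom p ∣    = 1
∣ natom p ∣   = 2
∣ a ∧' b ∣    = suc (∣ a ∣ + ∣ b ∣)
∣ a ∨' b ∣    = suc (∣ a ∣ + ∣ b ∣)
∣ geq R n ψ ∣ = suc (bitlen n + ∣ ψ ∣)
∣ leq R n ψ ∣ = suc (bitlen n + ∣ ψ ∣)

data Clos (φ : Fm) : Fm → Set where
  self : Clos φ φ
  ∧ˡ   : ∀ {a b} → Clos φ (a ∧' b) → Clos φ a
  ∧ʳ   : ∀ {a b} → Clos φ (a ∧' b) → Clos φ b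
  ∨ˡ   : ∀ {a b} → Clos φ (a ∨' b) → Clos φ a
  ∨ʳ   : ∀ {a b} → Clos φ (a ∨' b) → Clos φ b
  geqA : ∀ {R n ψ} → Clos φ (geq R n ψ) → Clos φ ψ
  leqA : ∀ {R n ψ} → Clos φ (leq R n ψ) → Clos φ ψ
  neg  : ∀ {ψ} → Clos φ ψ → Clos φ (∼ ψ)

_≟F_ : DecidableEquality Fm
atom p ≟F atom q with p ℕP.≟ q
... | yes refl = yes refl
... | no ne = no λ { refl → ne refl }
natom p ≟F natom q with p ℕP.≟ q
... | yes refl = yes refl
... | no ne = no λ { refl → ne refl }
(a ∧' b) ≟F (c ∧' d) with a ≟F c | b ≟F d
... | yes refl | yes refl = yes refl
... | no ne | _ = no λ { refl → ne refl }
... | _ | no ne = no λ { refl → ne refl }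
(a ∨' b) ≟F (c ∨' d) with a ≟F c | b ≟F d
... | yes refl | yes refl = yes refl
... | no ne | _ = no λ { refl → ne refl }
... | _ | no ne = no λ { refl → ne refl }
geq R n a ≟F geq R' n' b with R ℕP.≟ R' | n ℕP.≟ n' | a ≟F b
... | yes refl | yes refl | yes refl = yes refl
... | no ne | _ | _ = no λ { refl → ne refl }
... | _ | no ne | _ = no λ { refl → ne refl }
... | _ | _ | no ne = no λ { refl → ne refl }
leq R n a ≟F leq R' n' b with R ℕP.≟ R' | n ℕP.≟ n' | a ≟F b
... | yes refl | yes refl | yes refl = yes refl
... | no ne | _ | _ = no λ { refl → ne refl }
... | _ | no ne | _ = no λ { refl → ne refl }
... | _ | _ | no ne = no λ { refl → ne refl }
atom _ ≟F natom _ = no λ ()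
atom _ ≟F (_ ∧' _) = no λ ()
atom _ ≟F (_ ∨' _) = no λ ()
atom _ ≟F geq _ _ _ = no λ ()
atom _ ≟F leq _ _ _ = no λ ()
natom _ ≟F atom _ = no λ ()
natom _ ≟F (_ ∧' _) = no λ ()
natom _ ≟F (_ ∨' _) = no λ ()
natom _ ≟F geq _ _ _ = no λ ()
natom _ ≟F leq _ _ _ = no λ ()
(_ ∧' _) ≟F atom _ = no λ ()
(_ ∧' _) ≟F natom _ = no λ ()
(_ ∧' _) ≟F (_ ∨' _) = no λ ()
(_ ∧' _) ≟F geq _ _ _ = no λ ()
(_ ∧' _) ≟F leq _ _ _ = no λ ()
(_ ∨' _) ≟F atom _ = no λ ()
(_ ∨' _) ≟F natom _ = no λ ()
(_ ∨' _) ≟F (_ ∧' _) = no λ ()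
(_ ∨' _) ≟F geq _ _ _ = no λ ()
(_ ∨' _) ≟F leq _ _ _ = no λ ()
geq _ _ _ ≟F atom _ = no λ ()
geq _ _ _ ≟F natom _ = no λ ()
geq _ _ _ ≟F (_ ∧' _) = no λ ()
geq _ _ _ ≟F (_ ∨' _) = no λ ()
geq _ _ _ ≟F leq _ _ _ = no λ ()
leq _ _ _ ≟F atom _ = no λ ()
leq _ _ _ ≟F natom _ = no λ ()
leq _ _ _ ≟F (_ ∧' _) = no λ ()
leq _ _ _ ≟F (_ ∨' _) = no λ ()
leq _ _ _ ≟F geq _ _ _ = no λ ()

-- Constraints and constraint systems (finite sets, represented as lists;
-- only membership matters).  Variables are natural numbers.

data Con : Set where
  _⊨_ : ℕ → Fm → Con
  rel : ℕ → ℕ → ℕ → Con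

_≟C_ : DecidableEquality Con
(x ⊨ a) ≟C (y ⊨ b) with x ℕP.≟ y | a ≟F b
... | yes refl | yes refl = yes refl
... | no ne | _ = no λ { refl → ne refl }
... | _ | no ne = no λ { refl → ne refl }
rel R x y ≟C rel R' x' y' with R ℕP.≟ R' | x ℕP.≟ x' | y ℕP.≟ y'
... | yes refl | yes refl | yes refl = yes refl
... | no ne | _ | _ = no λ { refl → ne refl }
... | _ | no ne | _ = no λ { refl → ne refl }
... | _ | _ | no ne = no λ { refl → ne refl }
(_ ⊨ _) ≟C rel _ _ _ = no λ ()
rel _ _ _ ≟C (_ ⊨ _) = no λ ()

CS : Set
CS = List Con

open DecMem _≟C_ using () renaming (_∈?_ to _∈?C_)

witnesses : ℕ → ℕ → Fm → CS → List ℕ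
witnesses R x ψ S = deduplicate ℕP._≟_ (mapMaybe f S)
  where
  f : Con → Maybe ℕ
  f (rel R' x' y) =
    if does (R' ℕP.≟ R) then
      (if does (x' ℕP.≟ x) then
        (if does ((y ⊨ ψ) ∈?C S) then just y else nothing)
       else nothing)
    else nothing
  f (_ ⊨ _) = nothing

♯ : ℕ → CS → ℕ → Fm → ℕ
♯ R S x ψ = length (witnesses R x ψ S)

qualifiers : ℕ → ℕ → CS → List Fm
qualifiers R x S = mapMaybe f S
  where
  f : Con → Maybe Fm
  f (x' ⊨ geq R' m ψ) =
    if does (x' ℕP.≟ x) then (if does (R' ℕP.≟ R) then just ψ else nothing) else nothing
  f (x' ⊨ leq R' m ψ) =
    if does (x' ℕP.≟ x) then (if does (R' ℕP.≟ R) then just ψ else nothing) else nothing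
  f _ = nothing

varsC : Con → List ℕ
varsC (x ⊨ _)     = x ∷ []
varsC (rel _ x y) = x ∷ y ∷ []

Fresh : ℕ → CS → Set
Fresh y S = ∀ c → c ∈ S → y ∉ varsC c

∧-applicable : CS → ℕ → Set
∧-applicable S x = ∃[ a ] ∃[ b ] ((x ⊨ (a ∧' b)) ∈ S × ¬ ((x ⊨ a) ∈ S × (x ⊨ b) ∈ S))

∨-applicable : CS → ℕ → Set
∨-applicable S x = ∃[ a ] ∃[ b ] ((x ⊨ (a ∨' b)) ∈ S × (x ⊨ a) ∉ S × (x ⊨ b) ∉ S)

data Step : CS → CS → Set where
  ∧-rule : ∀ {S x a b} →
    (x ⊨ (a ∧' b)) ∈ S → ¬ ((x ⊨ a) ∈ S × (x ⊨ b) ∈ S) →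
    Step S ((x ⊨ a) ∷ (x ⊨ b) ∷ S)
  ∨-rule : ∀ {S x a b χ} →
    (x ⊨ (a ∨' b)) ∈ S → (x ⊨ a) ∉ S → (x ⊨ b) ∉ S →
    (χ ≡ a ⊎ χ ≡ b) →
    Step S ((x ⊨ χ) ∷ S)
  ≥-rule : ∀ {S x R n ψ} y (choice : Fm → Bool) →
    (x ⊨ geq R n ψ) ∈ S → ♯ R S x ψ < n →
    ¬ ∧-applicable S x → ¬ ∨-applicable S x →
    Fresh y S →
    Step S (rel R x y ∷ (y ⊨ ψ) ∷
            map (λ ψ' → y ⊨ (if choice ψ' then ψ' else ∼ ψ')) (qualifiers R x S)
            ++ S)

Generated : ℕ → Fm → CS → Set
Generated x₀ φ S = Star Step ((x₀ ⊨ φ) ∷ []) S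

Edge : CS → ℕ → ℕ → Set
Edge S x y = ∃[ R ] (rel R x y ∈ S)

-- PathG S x z k : a path of length k (k edges) from x to z in G(S)
data PathG (S : CS) : ℕ → ℕ → ℕ → Set where
  []  : ∀ {x} → PathG S x x 0
  _∷_ : ∀ {x y z k} → Edge S x y → PathG S y z k → PathG S x z (suc k)

succs : CS → ℕ → List ℕ
succs S x = deduplicate ℕP._≟_ (mapMaybe f S)
  where
  f : Con → Maybe ℕ
  f (rel _ x' y) = if does (x' ℕP.≟ x) then just y else nothing
  f (_ ⊨ _) = nothing

outdeg : CS → ℕ → ℕ
outdeg S x = length (succs S x)

{-# OPTIONS --safe #-}
module Submission where

-- Give every variable a level: x₀ gets the modal depth of φ, and the fresh successor created
-- by the ≥-rule at x gets level x − 1.  Every formula asserted at x has modal depth at most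
-- level x, so levels strictly decrease along the edges of G(S), and a path has at most
-- md φ ≤ |φ| edges.
-- All formulas in S lie in clos(φ), whose grades are below 2^|φ|.  The ≥-rule fires at x for
-- ⟨R⟩≥n ψ only while ♯R(x,ψ) < n, and it increases ♯R(x,ψ).  Hence the out-degree of x never
-- exceeds the potential  Σ { min(n, ♯R(x,ψ)) | ⟨R⟩≥n ψ ∈ clos(φ) } ≤ |clos(φ)| · 2^|φ|.

open import Defs
open import Data.Nat using (ℕ; zero; suc; pred; _+_; _*_; _^_; _⊔_; _⊓_; _≤_; _<_; z≤n; s≤s)
open import Data.Nat.Properties
open import Data.Nat.ListAction using (sum)
open import Data.Nat.Logarithm using (⌊log₂_⌋; ⌊log₂⌋-mono-≤; ⌊log₂[2^n]⌋≡n)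
open import Data.Bool using (Bool; true; false; if_then_else_)
open import Data.Maybe using (Maybe; just; nothing)
open import Data.List using (List; []; _∷_; _++_; length; map; mapMaybe; deduplicate)
open import Data.List.Properties using (length-++-sucʳ)
open import Data.List.Membership.Propositional using (_∈_; _∉_)
open import Data.List.Membership.Propositional.Properties
  using (∈-++⁺ˡ; ∈-++⁺ʳ; ∈-++⁻; ∈-∃++; ∈-deduplicate⁻; ∈-deduplicate⁺)
import Data.List.Membership.DecPropositional as DecMembership
open import Data.List.Relation.Binary.Subset.Propositional using (_⊆_)
open import Data.List.Relation.Unary.Any using (here; there)
open import Data.List.Relation.Unary.All as All using (All; []; _∷_)
open import Data.List.Relation.Unary.All.Properties using (++⁺; map⁺)
open import Data.List.Relation.Unary.AllPairs using (_∷_)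
open import Data.List.Relation.Unary.Unique.Propositional using (Unique)
open import Data.List.Relation.Unary.Unique.DecPropositional.Properties using (deduplicate-!)
open import Data.Product using (_×_; _,_; proj₁; proj₂; ∃-syntax)
open import Data.Sum using (_⊎_; inj₁; inj₂)
open import Data.Unit using (⊤; tt)
open import Data.Empty using (⊥; ⊥-elim)
open import Function using (_∘_)
open import Function.Bundles using (_⇔_; mk⇔; Equivalence)
open import Relation.Binary.PropositionalEquality
  using (_≡_; _≢_; refl; sym; trans; cong₂; subst; subst₂)
open import Relation.Nullary using (Dec; yes; no; does; contradiction)
open import Relation.Binary.Construct.Closure.ReflexiveTransitive using (Star; ε; _◅_)
open import Relation.Nullary.Decidable using (dec-true)

open DecMembership _≟C_ using () renaming (_∈?_ to _∈?C_)

unique-⊆⇒length≤ : ∀ {A : Set} {xs ys : List A} → Unique xs → xs ⊆ ys → length xs ≤ length ys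
unique-⊆⇒length≤ {xs = []} _ _ = z≤n
unique-⊆⇒length≤ {xs = x ∷ xs} (x∉xs ∷ u) xs⊆ys with as , bs , refl ← ∈-∃++ (xs⊆ys (here refl))
  rewrite length-++-sucʳ as x bs =
  s≤s (unique-⊆⇒length≤ u (λ z∈xs → skip as (xs⊆ys (there z∈xs)) (All.lookup x∉xs z∈xs)))
  where
  skip : ∀ {A : Set} (as : List A) {bs x z} → z ∈ as ++ x ∷ bs → x ≢ z → z ∈ as ++ bs
  skip []       (here refl) x≢z = contradiction refl x≢z
  skip []       (there z∈)  _   = z∈
  skip (a ∷ as) (here refl) _   = here refl
  skip (a ∷ as) (there z∈)  x≢z = there (skip as z∈ x≢z)

module _ {A B : Set} (f : A → Maybe B) where

  ∈-mapMaybe⁻ : ∀ {xs y} → y ∈ mapMaybe f xs → ∃[ x ] (x ∈ xs × f x ≡ just y)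
  ∈-mapMaybe⁻ {x ∷ xs} y∈ with f x in fx
  ∈-mapMaybe⁻ {x ∷ xs} (here refl) | just _ = x , here refl , fx
  ∈-mapMaybe⁻ {x ∷ xs} (there y∈)  | just _ with x′ , x′∈ , fx′ ← ∈-mapMaybe⁻ y∈ = x′ , there x′∈ , fx′
  ∈-mapMaybe⁻ {x ∷ xs} y∈          | nothing with x′ , x′∈ , fx′ ← ∈-mapMaybe⁻ y∈ = x′ , there x′∈ , fx′

  ∈-mapMaybe⁺ : ∀ {xs x y} → x ∈ xs → f x ≡ just y → y ∈ mapMaybe f xs
  ∈-mapMaybe⁺ {x ∷ xs} (here refl) fx rewrite fx = here refl
  ∈-mapMaybe⁺ {x ∷ xs} (there x∈) fx with f x
  ... | just _  = there (∈-mapMaybe⁺ x∈ fx)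
  ... | nothing = ∈-mapMaybe⁺ x∈ fx

if-does-just⁻ : ∀ {P A : Set} (p? : Dec P) {u : Maybe A} {y} →
  (if does p? then u else nothing) ≡ just y → P × u ≡ just y
if-does-just⁻ (yes p) u≡ = p , u≡

if-does-yes : ∀ {P A : Set} (p? : Dec P) {u v : A} → P → (if does p? then u else v) ≡ u
if-does-yes p? p rewrite dec-true p? p = refl

module _ {A : Set} (f g : A → ℕ) where

  sum-map-mono : ∀ xs → (∀ a → f a ≤ g a) → sum (map f xs) ≤ sum (map g xs)
  sum-map-mono []       _   = z≤n
  sum-map-mono (x ∷ xs) f≤g = +-mono-≤ (f≤g x) (sum-map-mono xs f≤g)

  sum-map-mono-< : ∀ {xs a} → (∀ a → f a ≤ g a) → a ∈ xs → f a < g a → sum (map f xs) < sum (map g xs)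
  sum-map-mono-< {x ∷ xs} f≤g (here refl) fa<ga = +-mono-<-≤ fa<ga (sum-map-mono xs f≤g)
  sum-map-mono-< {x ∷ xs} f≤g (there a∈)  fa<ga = +-mono-≤-< (f≤g x) (sum-map-mono-< f≤g a∈ fa<ga)

sum-map-≤-length* : ∀ {A : Set} (f : A → ℕ) xs {B} → (∀ {a} → a ∈ xs → f a ≤ B) →
  sum (map f xs) ≤ length xs * B
sum-map-≤-length* f []       _   = z≤n
sum-map-≤-length* f (x ∷ xs) f≤B = +-mono-≤ (f≤B (here refl)) (sum-map-≤-length* f xs (f≤B ∘ there))

module _ {R x : ℕ} {ψ : Fm} {S : CS} where

  ∈-witnesses⁻ : ∀ {y} → y ∈ witnesses R x ψ S → rel R x y ∈ S × (y ⊨ ψ) ∈ S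
  ∈-witnesses⁻ y∈ with ∈-mapMaybe⁻ _ {S} (∈-deduplicate⁻ _≟_ (mapMaybe _ S) y∈)
  ... | rel R′ x′ y′ , c∈S , fc
        with refl , fc ← if-does-just⁻ (R′ ≟ R) fc
        with refl , fc ← if-does-just⁻ (x′ ≟ x) fc
        with y⊨ψ , refl ← if-does-just⁻ ((y′ ⊨ ψ) ∈?C S) fc = c∈S , y⊨ψ

  ∈-witnesses⁺ : ∀ {y} → rel R x y ∈ S → (y ⊨ ψ) ∈ S → y ∈ witnesses R x ψ S
  ∈-witnesses⁺ {y} r∈ y⊨ψ = ∈-deduplicate⁺ _≟_ (∈-mapMaybe⁺ _ r∈
    (trans (if-does-yes (R ≟ R) refl)
      (trans (if-does-yes (x ≟ x) refl) (if-does-yes ((y ⊨ ψ) ∈?C S) y⊨ψ))))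

module _ {S : CS} {x : ℕ} where

  ∈-succs⁻ : ∀ {y} → y ∈ succs S x → Edge S x y
  ∈-succs⁻ y∈ with ∈-mapMaybe⁻ _ {S} (∈-deduplicate⁻ _≟_ (mapMaybe _ S) y∈)
  ... | rel R x′ y′ , c∈S , fc with refl , refl ← if-does-just⁻ (x′ ≟ x) fc = R , c∈S

  ∈-succs⁺ : ∀ {R y} → rel R x y ∈ S → y ∈ succs S x
  ∈-succs⁺ r∈ = ∈-deduplicate⁺ _≟_ (∈-mapMaybe⁺ _ r∈ (if-does-yes (x ≟ x) refl))

∈-qualifiers⁻ : ∀ {R x S ψ} → ψ ∈ qualifiers R x S →
  ∃[ m ] ((x ⊨ geq R m ψ) ∈ S ⊎ (x ⊨ leq R m ψ) ∈ S)
∈-qualifiers⁻ {R} {x} {S} ψ∈ with ∈-mapMaybe⁻ _ {S} ψ∈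
... | (x′ ⊨ geq R′ m _) , c∈S , fc
      with refl , fc ← if-does-just⁻ (x′ ≟ x) fc
      with refl , refl ← if-does-just⁻ (R′ ≟ R) fc = m , inj₁ c∈S
... | (x′ ⊨ leq R′ m _) , c∈S , fc
      with refl , fc ← if-does-just⁻ (x′ ≟ x) fc
      with refl , refl ← if-does-just⁻ (R′ ≟ R) fc = m , inj₂ c∈S

Clos-trans : ∀ {φ ψ χ} → Clos φ ψ → Clos ψ χ → Clos φ χ
Clos-trans c self     = c
Clos-trans c (∧ˡ d)   = ∧ˡ (Clos-trans c d)
Clos-trans c (∧ʳ d)   = ∧ʳ (Clos-trans c d)
Clos-trans c (∨ˡ d)   = ∨ˡ (Clos-trans c d)
Clos-trans c (∨ʳ d)   = ∨ʳ (Clos-trans c d)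
Clos-trans c (geqA d) = geqA (Clos-trans c d)
Clos-trans c (leqA d) = leqA (Clos-trans c d)
Clos-trans c (neg d)  = neg (Clos-trans c d)

∼∼∼≡∼ : ∀ χ → ∼ ∼ ∼ χ ≡ ∼ χ
∼∼∼≡∼ (atom _)          = refl
∼∼∼≡∼ (natom _)         = refl
∼∼∼≡∼ (a ∧' b)          = cong₂ _∨'_ (∼∼∼≡∼ a) (∼∼∼≡∼ b)
∼∼∼≡∼ (a ∨' b)          = cong₂ _∧'_ (∼∼∼≡∼ a) (∼∼∼≡∼ b)
∼∼∼≡∼ (geq _ zero _)    = refl
∼∼∼≡∼ (geq _ (suc _) _) = refl
∼∼∼≡∼ (leq _ _ _)       = refl

immediate : Fm → List Fm
immediate (atom _)    = []
immediate (natom _)   = []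
immediate (a ∧' b)    = a ∷ b ∷ []
immediate (a ∨' b)    = a ∷ b ∷ []
immediate (geq _ _ ψ) = ψ ∷ []
immediate (leq _ _ ψ) = ψ ∷ []

ClosedAt : List Fm → Fm → Set
ClosedAt M χ = ∼ χ ∈ M × All (_∈ M) (immediate χ)

Closed : List Fm → Set
Closed M = ∀ {χ} → χ ∈ M → ClosedAt M χ

ClosedAt-⊆ : ∀ {M N χ} → M ⊆ N → ClosedAt M χ → ClosedAt N χ
ClosedAt-⊆ M⊆N (∼χ∈ , sub∈) = M⊆N ∼χ∈ , All.map M⊆N sub∈

Closed⇒Clos⊆ : ∀ {M φ χ} → Closed M → φ ∈ M → Clos φ χ → χ ∈ M
Closed⇒Clos⊆ cM φ∈ self = φ∈
Closed⇒Clos⊆ cM φ∈ (∧ˡ c) with _ , a∈ ∷ _ ← cM (Closed⇒Clos⊆ cM φ∈ c) = a∈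
Closed⇒Clos⊆ cM φ∈ (∧ʳ c) with _ , _ ∷ b∈ ∷ _ ← cM (Closed⇒Clos⊆ cM φ∈ c) = b∈
Closed⇒Clos⊆ cM φ∈ (∨ˡ c) with _ , a∈ ∷ _ ← cM (Closed⇒Clos⊆ cM φ∈ c) = a∈
Closed⇒Clos⊆ cM φ∈ (∨ʳ c) with _ , _ ∷ b∈ ∷ _ ← cM (Closed⇒Clos⊆ cM φ∈ c) = b∈
Closed⇒Clos⊆ cM φ∈ (geqA c) with _ , ψ∈ ∷ _ ← cM (Closed⇒Clos⊆ cM φ∈ c) = ψ∈
Closed⇒Clos⊆ cM φ∈ (leqA c) with _ , ψ∈ ∷ _ ← cM (Closed⇒Clos⊆ cM φ∈ c) = ψ∈
Closed⇒Clos⊆ cM φ∈ (neg c) = proj₁ (cM (Closed⇒Clos⊆ cM φ∈ c))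

++-Closed : ∀ {M N} → Closed M → Closed N → Closed (M ++ N)
++-Closed {M} cM cN χ∈ with ∈-++⁻ M χ∈
... | inj₁ χ∈M = ClosedAt-⊆ ∈-++⁺ˡ (cM χ∈M)
... | inj₂ χ∈N = ClosedAt-⊆ (∈-++⁺ʳ M) (cN χ∈N)

triple : Fm → List Fm
triple χ = χ ∷ ∼ χ ∷ ∼ ∼ χ ∷ []

triple-sound : ∀ {φ χ} → Clos φ χ → All (Clos φ) (triple χ)
triple-sound c = c ∷ neg c ∷ neg (neg c) ∷ []

-- ∼ ∼ ∼ χ ≡ ∼ χ is what makes three negation levels enough.
triple-++-Closed : ∀ {M χ} → Closed M →
  All (_∈ M) (immediate χ) → All (_∈ M) (immediate (∼ χ)) → All (_∈ M) (immediate (∼ ∼ χ)) →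
  Closed (triple χ ++ M)
triple-++-Closed {M} {χ} cM i₀ i₁ i₂ = closed
  where
  lift : ∀ {ψs} → All (_∈ M) ψs → All (_∈ triple χ ++ M) ψs
  lift = All.map (∈-++⁺ʳ (triple χ))

  closed : Closed (triple χ ++ M)
  closed (here refl)                 = there (here refl) , lift i₀
  closed (there (here refl))         = there (there (here refl)) , lift i₁
  closed (there (there (here refl))) =
    subst (_∈ triple χ ++ M) (sym (∼∼∼≡∼ χ)) (there (here refl)) , lift i₂
  closed (there (there (there χ∈)))  = ClosedAt-⊆ (∈-++⁺ʳ (triple χ)) (cM χ∈)

mutual
  closList : Fm → List Fm
  closList φ = triple φ ++ below φ

  below : Fm → List Fm
  below (atom _)          = []
  below (natom _)         = []
  below (a ∧' b)          = closList a ++ closList b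
  below (a ∨' b)          = closList a ++ closList b
  -- ∼ ⟨R⟩≥0 ψ is atom 0 ∧' natom 0, whose conjuncts are not subformulas of ψ.
  below (geq _ zero ψ)    = triple (atom 0) ++ closList ψ
  below (geq _ (suc _) ψ) = closList ψ
  below (leq _ _ ψ)       = closList ψ

via : ∀ {φ ψ χs} → Clos φ ψ → All (Clos ψ) χs → All (Clos φ) χs
via c = All.map (Clos-trans c)

mutual
  closList-sound : ∀ φ → All (Clos φ) (closList φ)
  closList-sound φ = ++⁺ (triple-sound self) (below-sound φ)

  below-sound : ∀ φ → All (Clos φ) (below φ)
  below-sound (atom _)          = []
  below-sound (natom _)         = []
  below-sound (a ∧' b)          =
    ++⁺ (via (∧ˡ self) (closList-sound a)) (via (∧ʳ self) (closList-sound b))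
  below-sound (a ∨' b)          =
    ++⁺ (via (∨ˡ self) (closList-sound a)) (via (∨ʳ self) (closList-sound b))
  below-sound (geq _ zero ψ)    = ++⁺ (triple-sound (∧ˡ (neg self))) (via (geqA self) (closList-sound ψ))
  below-sound (geq _ (suc _) ψ) = via (geqA self) (closList-sound ψ)
  below-sound (leq _ _ ψ)       = via (leqA self) (closList-sound ψ)

pair∈ : ∀ {a b ψ₁ ψ₂} → ψ₁ ∈ triple a → ψ₂ ∈ triple b → All (_∈ closList a ++ closList b) (ψ₁ ∷ ψ₂ ∷ [])
pair∈ {a} {b} ψ₁∈ ψ₂∈ =
  ∈-++⁺ˡ (∈-++⁺ˡ {ys = below a} ψ₁∈) ∷ ∈-++⁺ʳ (closList a) (∈-++⁺ˡ {ys = below b} ψ₂∈) ∷ []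

[]-Closed : Closed []
[]-Closed ()

closList-Closed : ∀ φ → Closed (closList φ)
closList-Closed (atom _)  = triple-++-Closed []-Closed [] [] []
closList-Closed (natom _) = triple-++-Closed []-Closed [] [] []
closList-Closed (a ∧' b)  = triple-++-Closed (++-Closed (closList-Closed a) (closList-Closed b))
  (pair∈ (here refl) (here refl)) (pair∈ (there (here refl)) (there (here refl)))
  (pair∈ (there (there (here refl))) (there (there (here refl))))
closList-Closed (a ∨' b)  = triple-++-Closed (++-Closed (closList-Closed a) (closList-Closed b))
  (pair∈ (here refl) (here refl)) (pair∈ (there (here refl)) (there (here refl)))
  (pair∈ (there (there (here refl))) (there (there (here refl))))
closList-Closed (geq _ zero ψ) =
  triple-++-Closed (++-Closed (triple-++-Closed {χ = atom 0} []-Closed [] [] []) (closList-Closed ψ))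
    (∈-++⁺ʳ (triple (atom 0)) (here refl) ∷ []) (here refl ∷ there (here refl) ∷ [])
    (there (here refl) ∷ here refl ∷ [])
closList-Closed (geq _ (suc _) ψ) =
  triple-++-Closed (closList-Closed ψ) (here refl ∷ []) (here refl ∷ []) (here refl ∷ [])
closList-Closed (leq _ _ ψ) =
  triple-++-Closed (closList-Closed ψ) (here refl ∷ []) (here refl ∷ []) (here refl ∷ [])

closure : Fm → List Fm
closure φ = deduplicate _≟F_ (closList φ)

closure-unique : ∀ φ → Unique (closure φ)
closure-unique φ = deduplicate-! _≟F_ (closList φ)

∈-closure⇔Clos : ∀ φ ψ → ψ ∈ closure φ ⇔ Clos φ ψ
∈-closure⇔Clos φ ψ = mk⇔
  (All.lookup (closList-sound φ) ∘ ∈-deduplicate⁻ _≟F_ (closList φ))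
  (∈-deduplicate⁺ _≟F_ ∘ Closed⇒Clos⊆ (closList-Closed φ) (here refl))

modalDepth : Fm → ℕ
modalDepth (atom _)    = 0
modalDepth (natom _)   = 0
modalDepth (a ∧' b)    = modalDepth a ⊔ modalDepth b
modalDepth (a ∨' b)    = modalDepth a ⊔ modalDepth b
modalDepth (geq _ _ ψ) = suc (modalDepth ψ)
modalDepth (leq _ _ ψ) = suc (modalDepth ψ)

modalDepth-∼ : ∀ χ → modalDepth (∼ χ) ≤ modalDepth χ
modalDepth-∼ (atom _)          = z≤n
modalDepth-∼ (natom _)         = z≤n
modalDepth-∼ (a ∧' b)          = ⊔-mono-≤ (modalDepth-∼ a) (modalDepth-∼ b)
modalDepth-∼ (a ∨' b)          = ⊔-mono-≤ (modalDepth-∼ a) (modalDepth-∼ b)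
modalDepth-∼ (geq _ zero _)    = z≤n
modalDepth-∼ (geq _ (suc _) _) = ≤-refl
modalDepth-∼ (leq _ _ _)       = ≤-refl

modalDepth≤size : ∀ χ → modalDepth χ ≤ ∣ χ ∣
modalDepth≤size (atom _)    = z≤n
modalDepth≤size (natom _)   = z≤n
modalDepth≤size (a ∧' b)    =
  m≤n⇒m≤1+n (≤-trans (⊔-mono-≤ (modalDepth≤size a) (modalDepth≤size b)) (m⊔n≤m+n ∣ a ∣ ∣ b ∣))
modalDepth≤size (a ∨' b)    =
  m≤n⇒m≤1+n (≤-trans (⊔-mono-≤ (modalDepth≤size a) (modalDepth≤size b)) (m⊔n≤m+n ∣ a ∣ ∣ b ∣))
modalDepth≤size (geq _ n ψ) = s≤s (≤-trans (modalDepth≤size ψ) (m≤n+m _ (bitlen n)))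
modalDepth≤size (leq _ n ψ) = s≤s (≤-trans (modalDepth≤size ψ) (m≤n+m _ (bitlen n)))

-- ⟨R⟩≤n ψ is refuted by n + 1 successors, so it is graded n + 1; this makes the bound stable under ∼.
GradesAtMost : ℕ → Fm → Set
GradesAtMost B (atom _)    = ⊤
GradesAtMost B (natom _)   = ⊤
GradesAtMost B (a ∧' b)    = GradesAtMost B a × GradesAtMost B b
GradesAtMost B (a ∨' b)    = GradesAtMost B a × GradesAtMost B b
GradesAtMost B (geq _ n ψ) = n ≤ B × GradesAtMost B ψ
GradesAtMost B (leq _ n ψ) = suc n ≤ B × GradesAtMost B ψ

GradesAtMost-∼ : ∀ {B} χ → GradesAtMost B χ → GradesAtMost B (∼ χ)
GradesAtMost-∼ (atom _)          _         = tt
GradesAtMost-∼ (natom _)         _         = tt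
GradesAtMost-∼ (a ∧' b)          (ga , gb) = GradesAtMost-∼ a ga , GradesAtMost-∼ b gb
GradesAtMost-∼ (a ∨' b)          (ga , gb) = GradesAtMost-∼ a ga , GradesAtMost-∼ b gb
GradesAtMost-∼ (geq _ zero _)    _         = tt , tt
GradesAtMost-∼ (geq _ (suc _) _) g         = g
GradesAtMost-∼ (leq _ _ _)       g         = g

n<2^bitlen : ∀ n → n < 2 ^ bitlen n
n<2^bitlen n with 2 ^ bitlen n ≤? n
... | no 2^bitlen≰n = ≰⇒> 2^bitlen≰n
... | yes 2^bitlen≤n =
  contradiction (subst (_≤ ⌊log₂ n ⌋) (⌊log₂[2^n]⌋≡n (bitlen n)) (⌊log₂⌋-mono-≤ 2^bitlen≤n)) 1+n≰n

bitlen≤⇒<2^ : ∀ {n m} → bitlen n ≤ m → n < 2 ^ m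
bitlen≤⇒<2^ {n} bitlen≤m = ≤-trans (n<2^bitlen n) (^-monoʳ-≤ 2 bitlen≤m)

m+n<o⇒m≤o : ∀ {m n o} → m + n < o → m ≤ o
m+n<o⇒m≤o {m} = m+n≤o⇒m≤o m ∘ <⇒≤

m+n<o⇒n≤o : ∀ m {n o} → m + n < o → n ≤ o
m+n<o⇒n≤o m = m+n≤o⇒n≤o m ∘ <⇒≤

GradesAtMost-2^ : ∀ χ {m} → ∣ χ ∣ ≤ m → GradesAtMost (2 ^ m) χ
GradesAtMost-2^ (atom _)    _   = tt
GradesAtMost-2^ (natom _)   _   = tt
GradesAtMost-2^ (a ∧' b)    ≤m  = GradesAtMost-2^ a (m+n<o⇒m≤o ≤m) , GradesAtMost-2^ b (m+n<o⇒n≤o ∣ a ∣ ≤m)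
GradesAtMost-2^ (a ∨' b)    ≤m  = GradesAtMost-2^ a (m+n<o⇒m≤o ≤m) , GradesAtMost-2^ b (m+n<o⇒n≤o ∣ a ∣ ≤m)
GradesAtMost-2^ (geq _ n ψ) ≤m  = <⇒≤ (bitlen≤⇒<2^ (m+n<o⇒m≤o ≤m)) , GradesAtMost-2^ ψ (m+n<o⇒n≤o (bitlen n) ≤m)
GradesAtMost-2^ (leq _ n ψ) ≤m  = bitlen≤⇒<2^ (m+n<o⇒m≤o ≤m) , GradesAtMost-2^ ψ (m+n<o⇒n≤o (bitlen n) ≤m)

Clos⇒GradesAtMost : ∀ {φ χ} → Clos φ χ → GradesAtMost (2 ^ ∣ φ ∣) χ
Clos⇒GradesAtMost {φ} self = GradesAtMost-2^ φ ≤-refl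
Clos⇒GradesAtMost (∧ˡ c)   = proj₁ (Clos⇒GradesAtMost c)
Clos⇒GradesAtMost (∧ʳ c)   = proj₂ (Clos⇒GradesAtMost c)
Clos⇒GradesAtMost (∨ˡ c)   = proj₁ (Clos⇒GradesAtMost c)
Clos⇒GradesAtMost (∨ʳ c)   = proj₂ (Clos⇒GradesAtMost c)
Clos⇒GradesAtMost (geqA c) = proj₂ (Clos⇒GradesAtMost c)
Clos⇒GradesAtMost (leqA c) = proj₂ (Clos⇒GradesAtMost c)
Clos⇒GradesAtMost (neg c)  = GradesAtMost-∼ _ (Clos⇒GradesAtMost c)

outdeg≤length : ∀ {S x ws} → (∀ {R w} → rel R x w ∈ S → w ∈ ws) → outdeg S x ≤ length ws
outdeg≤length {S} {x} succ∈ws =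
  unique-⊆⇒length≤ {xs = succs S x} (deduplicate-! _≟_ _) (λ w∈ → succ∈ws (proj₂ (∈-succs⁻ w∈)))

witnesses-⊆ : ∀ {S S′} R x ψ → S ⊆ S′ → witnesses R x ψ S ⊆ witnesses R x ψ S′
witnesses-⊆ R x ψ S⊆S′ w∈ = let r∈ , w⊨ψ = ∈-witnesses⁻ w∈ in ∈-witnesses⁺ (S⊆S′ r∈) (S⊆S′ w⊨ψ)

♯-mono : ∀ {S S′} R x ψ → S ⊆ S′ → ♯ R S x ψ ≤ ♯ R S′ x ψ
♯-mono {S} R x ψ S⊆S′ =
  unique-⊆⇒length≤ {xs = witnesses R x ψ S} (deduplicate-! _≟_ _) (witnesses-⊆ R x ψ S⊆S′)

♯-new-witness : ∀ {S S′ R x y ψ} → S ⊆ S′ → rel R x y ∉ S → rel R x y ∈ S′ → (y ⊨ ψ) ∈ S′ →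
  ♯ R S x ψ < ♯ R S′ x ψ
♯-new-witness {S} {S′} {R} {x} {y} {ψ} S⊆S′ r∉S r∈S′ y⊨ψ =
  unique-⊆⇒length≤ {xs = y ∷ witnesses R x ψ S} (All.tabulate y≢ ∷ deduplicate-! _≟_ _) λ where
    (here refl) → ∈-witnesses⁺ r∈S′ y⊨ψ
    (there w∈)  → witnesses-⊆ R x ψ S⊆S′ w∈
  where
  y≢ : ∀ {w} → w ∈ witnesses R x ψ S → y ≢ w
  y≢ w∈ refl = r∉S (proj₁ (∈-witnesses⁻ w∈))

budget : CS → ℕ → Fm → ℕ
budget S x (geq R n ψ) = n ⊓ ♯ R S x ψ
budget S x _           = 0

potential : Fm → CS → ℕ → ℕ
potential φ S x = sum (map (budget S x) (closure φ))

budget-mono : ∀ {S S′} x → S ⊆ S′ → ∀ χ → budget S x χ ≤ budget S′ x χ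
budget-mono x S⊆S′ (geq R n ψ) = ⊓-monoʳ-≤ n (♯-mono R x ψ S⊆S′)
budget-mono x S⊆S′ (atom _)    = z≤n
budget-mono x S⊆S′ (natom _)   = z≤n
budget-mono x S⊆S′ (_ ∧' _)    = z≤n
budget-mono x S⊆S′ (_ ∨' _)    = z≤n
budget-mono x S⊆S′ (leq _ _ _) = z≤n

budget≤2^ : ∀ {φ χ} S x → Clos φ χ → budget S x χ ≤ 2 ^ ∣ φ ∣
budget≤2^ {χ = geq _ n _} S x c = ≤-trans (m⊓n≤m n _) (proj₁ (Clos⇒GradesAtMost c))
budget≤2^ {χ = atom _}    S x c = z≤n
budget≤2^ {χ = natom _}   S x c = z≤n
budget≤2^ {χ = _ ∧' _}    S x c = z≤n
budget≤2^ {χ = _ ∨' _}    S x c = z≤n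
budget≤2^ {χ = leq _ _ _} S x c = z≤n

potential-mono : ∀ φ {S S′} x → S ⊆ S′ → potential φ S x ≤ potential φ S′ x
potential-mono φ x S⊆S′ = sum-map-mono _ _ (closure φ) (budget-mono x S⊆S′)

potential-< : ∀ {φ S S′ x R n ψ} → Clos φ (geq R n ψ) → ♯ R S x ψ < n → S ⊆ S′ →
  ♯ R S x ψ < ♯ R S′ x ψ → potential φ S x < potential φ S′ x
potential-< {φ} {S} {S′} {x} {R} {n} {ψ} c ♯<n S⊆S′ ♯<♯′ =
  sum-map-mono-< _ _ (budget-mono x S⊆S′) (Equivalence.from (∈-closure⇔Clos φ _) c) budget<
  where
  budget< : n ⊓ ♯ R S x ψ < n ⊓ ♯ R S′ x ψ
  budget< = subst (_< n ⊓ ♯ R S′ x ψ) (sym (m≥n⇒m⊓n≡n (<⇒≤ ♯<n))) (⊓-glb ♯<n ♯<♯′)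

potential≤ : ∀ φ S x → potential φ S x ≤ length (closure φ) * 2 ^ ∣ φ ∣
potential≤ φ S x = sum-map-≤-length* _ (closure φ) (budget≤2^ S x ∘ Equivalence.to (∈-closure⇔Clos φ _))

record Invariant (φ : Fm) (level : ℕ → ℕ) (S : CS) : Set where
  field
    ⊨-Clos           : ∀ {x ψ} → (x ⊨ ψ) ∈ S → Clos φ ψ
    ⊨-depth≤level    : ∀ {x ψ} → (x ⊨ ψ) ∈ S → modalDepth ψ ≤ level x
    rel-level<       : ∀ {R x y} → rel R x y ∈ S → level y < level x
    level≤depth      : ∀ x → level x ≤ modalDepth φ
    outdeg≤potential : ∀ x → outdeg S x ≤ potential φ S x

open Invariant

PathG-length≤level : ∀ {φ level S x z k} → Invariant φ level S → PathG S x z k → k ≤ level x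
PathG-length≤level I []             = z≤n
PathG-length≤level I ((_ , r∈) ∷ p) = ≤-trans (s≤s (PathG-length≤level I p)) (rel-level< I r∈)

Invariant-[] : ∀ φ → Invariant φ (λ _ → modalDepth φ) []
Invariant-[] φ = record
  { ⊨-Clos           = λ ()
  ; ⊨-depth≤level    = λ ()
  ; rel-level<       = λ ()
  ; level≤depth      = λ _ → ≤-refl
  ; outdeg≤potential = λ _ → z≤n
  }

Admissible : Fm → (ℕ → ℕ) → Con → Set
Admissible φ level (x ⊨ ψ)     = Clos φ ψ × modalDepth ψ ≤ level x
Admissible φ level (rel _ _ _) = ⊥

extend : ∀ {φ level S c} → Admissible φ level c → Invariant φ level S → Invariant φ level (c ∷ S)
extend {φ} {c = x ⊨ χ} (c , d) I = record
  { ⊨-Clos           = λ { (here refl) → c ; (there ⊨∈) → ⊨-Clos I ⊨∈ }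
  ; ⊨-depth≤level    = λ { (here refl) → d ; (there ⊨∈) → ⊨-depth≤level I ⊨∈ }
  ; rel-level<       = λ { (here ()) ; (there r∈) → rel-level< I r∈ }
  ; level≤depth      = level≤depth I
  ; outdeg≤potential = λ v → ≤-trans (outdeg≤potential I v) (potential-mono φ v there)
  }

extend* : ∀ {φ level S cs} → All (Admissible φ level) cs → Invariant φ level S →
  Invariant φ level (cs ++ S)
extend* []       I = I
extend* (a ∷ as) I = extend a (extend* as I)

rel-∈-++⁻ : ∀ {φ level S cs R x y} → All (Admissible φ level) cs → rel R x y ∈ cs ++ S → rel R x y ∈ S
rel-∈-++⁻ {cs = cs} as r∈ with ∈-++⁻ cs r∈
... | inj₁ r∈cs = ⊥-elim (All.lookup as r∈cs)
... | inj₂ r∈S  = r∈S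

add-edge : ∀ {φ level S R x y} → Invariant φ level S → level y < level x →
  outdeg (rel R x y ∷ S) x ≤ potential φ (rel R x y ∷ S) x → Invariant φ level (rel R x y ∷ S)
add-edge {φ} {level} {S} {R} {x} {y} I y<x outdeg-x = record
  { ⊨-Clos           = λ { (here ()) ; (there ⊨∈) → ⊨-Clos I ⊨∈ }
  ; ⊨-depth≤level    = λ { (here ()) ; (there ⊨∈) → ⊨-depth≤level I ⊨∈ }
  ; rel-level<       = λ { (here refl) → y<x ; (there r∈) → rel-level< I r∈ }
  ; level≤depth      = level≤depth I
  ; outdeg≤potential = outdeg≤potential′
  }
  where
  outdeg≤potential′ : ∀ v → outdeg (rel R x y ∷ S) v ≤ potential φ (rel R x y ∷ S) v
  outdeg≤potential′ v with v ≟ x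
  ... | yes refl = outdeg-x
  ... | no v≢x   =
    ≤-trans (outdeg≤length succ∈) (≤-trans (outdeg≤potential I v) (potential-mono φ v there))
    where
    succ∈ : ∀ {R′ w} → rel R′ v w ∈ rel R x y ∷ S → w ∈ succs S v
    succ∈ (here refl) = contradiction refl v≢x
    succ∈ (there r∈)  = ∈-succs⁺ r∈

_[_≔_] : (ℕ → ℕ) → ℕ → ℕ → ℕ → ℕ
(f [ y ≔ ℓ ]) v with v ≟ y
... | yes _ = ℓ
... | no _  = f v

[≔]-≡ : ∀ f y ℓ → (f [ y ≔ ℓ ]) y ≡ ℓ
[≔]-≡ f y ℓ with y ≟ y
... | yes _   = refl
... | no y≢y = contradiction refl y≢y

[≔]-≢ : ∀ f {y ℓ v} → v ≢ y → (f [ y ≔ ℓ ]) v ≡ f v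
[≔]-≢ f {y} {v = v} v≢y with v ≟ y
... | yes v≡y = contradiction v≡y v≢y
... | no _    = refl

Fresh⇒≢ : ∀ {y S c v} → Fresh y S → c ∈ S → v ∈ varsC c → v ≢ y
Fresh⇒≢ fresh c∈ v∈ refl = fresh _ c∈ v∈

relevel : ∀ {φ level S y ℓ} → Invariant φ level S → Fresh y S → ℓ ≤ modalDepth φ →
  Invariant φ (level [ y ≔ ℓ ]) S
relevel {φ} {level} {S} {y} {ℓ} I fresh ℓ≤depth = record
  { ⊨-Clos           = ⊨-Clos I
  ; ⊨-depth≤level    = λ ⊨∈ → subst (_ ≤_) (sym (away ⊨∈ (here refl))) (⊨-depth≤level I ⊨∈)
  ; rel-level<       = λ r∈ → subst₂ _<_ (sym (away r∈ (there (here refl)))) (sym (away r∈ (here refl)))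
                                 (rel-level< I r∈)
  ; level≤depth      = level′≤depth
  ; outdeg≤potential = outdeg≤potential I
  }
  where
  away : ∀ {c v} → c ∈ S → v ∈ varsC c → (level [ y ≔ ℓ ]) v ≡ level v
  away c∈ v∈ = [≔]-≢ level (Fresh⇒≢ fresh c∈ v∈)

  level′≤depth : ∀ v → (level [ y ≔ ℓ ]) v ≤ modalDepth φ
  level′≤depth v with v ≟ y
  ... | yes _ = ℓ≤depth
  ... | no _  = level≤depth I v

qualifier-bounds : ∀ {φ level S R x ψ} → Invariant φ level S → ψ ∈ qualifiers R x S →
  Clos φ ψ × modalDepth ψ < level x
qualifier-bounds I ψ∈ with ∈-qualifiers⁻ ψ∈
... | _ , inj₁ x⊨ = geqA (⊨-Clos I x⊨) , ⊨-depth≤level I x⊨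
... | _ , inj₂ x⊨ = leqA (⊨-Clos I x⊨) , ⊨-depth≤level I x⊨

choice-bounds : ∀ {φ ψ ℓ} b → Clos φ ψ → modalDepth ψ ≤ ℓ →
  Clos φ (if b then ψ else ∼ ψ) × modalDepth (if b then ψ else ∼ ψ) ≤ ℓ
choice-bounds true  c d = c , d
choice-bounds {ψ = ψ} false c d = neg c , ≤-trans (modalDepth-∼ ψ) d

pred<self : ∀ {m n} → m < n → pred n < n
pred<self (s≤s _) = ≤-refl

≥-rule-preserves : ∀ {φ level S x R n ψ} → Invariant φ level S → ∀ y (choice : Fm → Bool) →
  (x ⊨ geq R n ψ) ∈ S → ♯ R S x ψ < n → Fresh y S →
  Invariant φ (level [ y ≔ pred (level x) ])
    (rel R x y ∷ (y ⊨ ψ) ∷ map (λ ψ′ → y ⊨ (if choice ψ′ then ψ′ else ∼ ψ′)) (qualifiers R x S) ++ S)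
≥-rule-preserves {φ} {level} {S} {x} {R} {n} {ψ} I y choice x⊨ ♯<n fresh =
  add-edge (extend* new-admissible (relevel I fresh ℓ≤depth)) y<x outdeg-x
  where
  ℓ : ℕ
  ℓ = pred (level x)

  level′ : ℕ → ℕ
  level′ = level [ y ≔ ℓ ]

  new : CS
  new = (y ⊨ ψ) ∷ map (λ ψ′ → y ⊨ (if choice ψ′ then ψ′ else ∼ ψ′)) (qualifiers R x S)

  S′ : CS
  S′ = rel R x y ∷ new ++ S

  ψ<level : modalDepth ψ < level x
  ψ<level = ⊨-depth≤level I x⊨

  ℓ≤depth : ℓ ≤ modalDepth φ
  ℓ≤depth = ≤-trans pred[n]≤n (level≤depth I x)

  level′y≡ℓ : level′ y ≡ ℓ
  level′y≡ℓ = [≔]-≡ level y ℓ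

  new-admissible : All (Admissible φ level′) new
  new-admissible = (geqA (⊨-Clos I x⊨) , subst (_ ≤_) (sym level′y≡ℓ) (<⇒≤pred ψ<level))
    ∷ map⁺ (All.tabulate λ {ψ′} ψ′∈ →
        let c , d = qualifier-bounds I ψ′∈ in
        choice-bounds (choice ψ′) c (subst (_ ≤_) (sym level′y≡ℓ) (<⇒≤pred d)))

  y<x : level′ y < level′ x
  y<x = subst₂ _<_ (sym level′y≡ℓ) (sym ([≔]-≢ level (Fresh⇒≢ fresh x⊨ (here refl)))) (pred<self ψ<level)

  succ∈ : ∀ {R′ w} → rel R′ x w ∈ S′ → w ∈ y ∷ succs S x
  succ∈ (here refl) = here refl
  succ∈ (there r∈)  = there (∈-succs⁺ (rel-∈-++⁻ new-admissible r∈))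

  S⊆S′ : S ⊆ S′
  S⊆S′ = there ∘ ∈-++⁺ʳ new

  ♯<♯′ : ♯ R S x ψ < ♯ R S′ x ψ
  ♯<♯′ = ♯-new-witness S⊆S′ y-new (here refl) (there (here refl))
    where
    y-new : rel R x y ∉ S
    y-new r∈ = Fresh⇒≢ fresh r∈ (there (here refl)) refl

  outdeg-x : outdeg S′ x ≤ potential φ S′ x
  outdeg-x = begin
    outdeg S′ x            ≤⟨ outdeg≤length succ∈ ⟩
    suc (outdeg S x)       ≤⟨ s≤s (outdeg≤potential I x) ⟩
    suc (potential φ S x)  ≤⟨ potential-< (⊨-Clos I x⊨) ♯<n S⊆S′ ♯<♯′ ⟩
    potential φ S′ x       ∎
    where open ≤-Reasoning

step-preserves : ∀ {φ level S S′} → Invariant φ level S → Step S S′ → ∃[ level′ ] Invariant φ level′ S′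
step-preserves I (∧-rule x⊨ _) =
  _ , extend (∧ˡ (⊨-Clos I x⊨) , ≤-trans (m≤m⊔n _ _) (⊨-depth≤level I x⊨))
        (extend (∧ʳ (⊨-Clos I x⊨) , ≤-trans (m≤n⊔m _ _) (⊨-depth≤level I x⊨)) I)
step-preserves I (∨-rule x⊨ _ _ (inj₁ refl)) =
  _ , extend (∨ˡ (⊨-Clos I x⊨) , ≤-trans (m≤m⊔n _ _) (⊨-depth≤level I x⊨)) I
step-preserves I (∨-rule x⊨ _ _ (inj₂ refl)) =
  _ , extend (∨ʳ (⊨-Clos I x⊨) , ≤-trans (m≤n⊔m _ _) (⊨-depth≤level I x⊨)) I
step-preserves I (≥-rule y choice x⊨ ♯<n _ _ fresh) = _ , ≥-rule-preserves I y choice x⊨ ♯<n fresh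

Generated⇒Invariant : ∀ {x₀ φ S} → Generated x₀ φ S → ∃[ level ] Invariant φ level S
Generated⇒Invariant {φ = φ} = run (_ , extend (self , ≤-refl) (Invariant-[] φ))
  where
  run : ∀ {S S′} → ∃[ level ] Invariant φ level S → Star Step S S′ → ∃[ level ] Invariant φ level S′
  run I₀      ε        = I₀
  run (_ , I) (s ◅ ss) = run (step-preserves I s) ss

lemma1 : (φ : Fm) (x₀ : ℕ) (S : CS) → Generated x₀ φ S →
    (∀ x z k → PathG S x z k → k ≤ ∣ φ ∣)
    × (∃[ cl ] (Unique cl × (∀ ψ → (ψ ∈ cl ⇔ Clos φ ψ))
                × (∀ x → outdeg S x ≤ length cl * 2 ^ ∣ φ ∣)))
lemma1 φ x₀ S generated = path-bound , closure φ , closure-unique φ , ∈-closure⇔Clos φ , outdeg-bound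
  where
  level : ℕ → ℕ
  level = proj₁ (Generated⇒Invariant generated)

  I : Invariant φ level S
  I = proj₂ (Generated⇒Invariant generated)

  path-bound : ∀ x z k → PathG S x z k → k ≤ ∣ φ ∣
  path-bound x _ _ p = ≤-trans (PathG-length≤level I p) (≤-trans (level≤depth I x) (modalDepth≤size φ))

  outdeg-bound : ∀ x → outdeg S x ≤ length (closure φ) * 2 ^ ∣ φ ∣
  outdeg-bound x = ≤-trans (outdeg≤potential I x) (potential≤ φ S x)
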